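{- Let $d$ be a squarefree integer having a prime factor congruent to $3$ modulo $4$, let $K = \mathbb{Q}(\sqrt{d})$, $\mathbb{Q}_1 = \mathbb{Q}(\sqrt 2)$ and $K_1 = K(\sqrt{2}) = \mathbb{Q}(\sqrt2,\sqrt d)$. Then $1+\sqrt{2}$ is not a norm from $K_1$ to $\mathbb{Q}_1$, i.e. there is no $\alpha \in K_1^\times$ with $N_{K_1/\mathbb{Q}_1}(\alpha) = 1+\sqrt2$. -}

module Defs where

open import Data.Nat as ℕ using (ℕ; _%_)
open import Data.Nat.Divisibility using (_∣_)
open import Data.Nat.Primality using (Prime)
open import Data.Integer as ℤ using (ℤ; ∣_∣)
open import Data.Rational as ℚ using (ℚ; 0ℚ; 1ℚ)
open import Data.Product using (_×_; _,_; ∃-syntax)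
open import Relation.Binary.PropositionalEquality using (_≡_)

-- A squarefree integer: no square of a natural number n > 1 divides it
-- (equivalently n² ∣ d ⇒ n = 1).  Note 0 is not squarefree.
SquareFree : ℤ → Set
SquareFree d = ∀ (n : ℕ) → (n ℕ.* n) ∣ ∣ d ∣ → n ≡ 1

HasPrimeFactor3mod4 : ℤ → Set
HasPrimeFactor3mod4 d = ∃[ p ] (Prime p × p ∣ ∣ d ∣ × p % 4 ≡ 3)

-- ℚ₁ = ℚ(√2): an element (x , y) represents x + y√2, x y ∈ ℚ.

Q₁ : Set
Q₁ = ℚ × ℚ

0Q₁ 1Q₁ : Q₁
0Q₁ = 0ℚ , 0ℚ
1Q₁ = 1ℚ , 0ℚ

1+√2 : Q₁
1+√2 = 1ℚ , 1ℚ

_+₁_ : Q₁ → Q₁ → Q₁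
(a , b) +₁ (c , e) = a ℚ.+ c , b ℚ.+ e

-₁_ : Q₁ → Q₁
-₁ (a , b) = ℚ.- a , ℚ.- b

_*₁_ : Q₁ → Q₁ → Q₁
(a , b) *₁ (c , e) = (a ℚ.* c ℚ.+ ((ℤ.+ 2 ℚ./ 1)) ℚ.* (b ℚ.* e)) , (a ℚ.* e ℚ.+ b ℚ.* c)

ιℤ : ℤ → Q₁
ιℤ d = (d ℚ./ 1) , 0ℚ

-- K₁ = ℚ₁(√d) = ℚ(√2, √d): an element (a , b) represents a + b√d with
-- a b ∈ ℚ₁ (for d squarefree with a prime factor ≡ 3 mod 4, √d ∉ ℚ₁,
-- so K₁/ℚ₁ is quadratic with ℚ₁-basis 1, √d).

K₁ : Set
K₁ = Q₁ × Q₁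

0K₁ : K₁
0K₁ = 0Q₁ , 0Q₁

ι : Q₁ → K₁
ι a = a , 0Q₁

mulK₁ : ℤ → K₁ → K₁ → K₁
mulK₁ d (a , b) (c , e) = (a *₁ c) +₁ (ιℤ d *₁ (b *₁ e)) , (a *₁ e) +₁ (b *₁ c)

σ : K₁ → K₁
σ (a , b) = a , -₁ b

-- norm N_{K₁/ℚ₁}(α) = α · σ(α) (an element of K₁ lying in ℚ₁)
NormK₁ : ℤ → K₁ → K₁
NormK₁ d α = mulK₁ d α (σ α)

-- Write α = a + b√d with a = q₁ + q₂√2 and b = q₃ + q₄√2. The rational part and the √2-part of
-- a² − d b² = 1 + √2 are both 1, and their difference is
--   (q₁ − q₂)² + q₂² − d ((q₃ − q₄)² + q₄²) = 0,
-- so it suffices to show that u² + v² = d (s² + t²) has no nontrivial rational solution.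
-- Let p ≡ 3 (mod 4) be a prime with p ∥ d. By Fermat's little theorem −1 is not a square mod p,
-- so p ∣ x² + y² forces p ∣ x and p ∣ y. Hence, in an integer solution, p divides u and v, then
-- p² ∣ d (s² + t²) with p² ∤ d gives p ∣ s² + t², so p divides s and t as well, and dividing by p
-- yields another solution. All entries are therefore divisible by every power of p, i.e. vanish.
module Submission where

open import Defs
open import Data.Fin as Fin using (Fin; inject₁; fromℕ; toℕ)
open import Data.Fin.Properties using (toℕ-inject₁; toℕ<n; toℕ-fromℕ)
open import Data.Nat as ℕ using (ℕ; zero; suc; _!; _∸_; _%_; _/_; z<s; s<s)
import Data.Nat.Properties as ℕ
import Data.Nat.Divisibility as ℕ
open import Data.Nat.Combinatorics using (_C_; nCk≡n!/k![n-k]!; k![n∸k]!∣n!; nCn≡1)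
open import Data.Nat.DivMod using (m/n*n≡m; m≡m%n+[m/n]*n)
open import Data.Nat.Primality using (Prime; euclidsLemma; ¬prime[1]; prime⇒nonZero; prime⇒nonTrivial)
open import Data.Integer as ℤ using (ℤ; +_; -[1+_]; 0ℤ; 1ℤ; _+_; _*_; _-_; -_; _^_)
open import Data.Integer.Properties as ℤ
  using (+-*-semiring; +-*-commutativeSemiring; *-identityˡ; *-identityʳ; ^-zeroˡ; ^-*-assoc)
open import Data.Integer.Divisibility.Signed
open import Data.Integer.Tactic.RingSolver using (solve-∀)
open import Data.Rational as ℚ using (ℚ; 0ℚ; ↥_; ↧_; toℚᵘ; fromℚᵘ)
import Data.Rational.Properties as ℚ
open import Data.Rational.Solver using (module +-*-Solver)
open import Data.Rational.Unnormalised as ℚᵘ using (mkℚᵘ; *≡*)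
import Data.Rational.Unnormalised.Properties as ℚᵘ
open import Data.Product as Product using (_×_; _,_; proj₁; proj₂; ∃-syntax)
open import Data.Sum as Sum using (_⊎_; inj₁; inj₂; [_,_]′)
open import Data.Empty using (⊥-elim)
open import Function using (id; _∘_)
open import Relation.Nullary using (¬_; yes; no)
open import Relation.Binary.PropositionalEquality

open import Algebra.Properties.Semiring.Sum +-*-semiring using (sum; sum-init-last)
import Algebra.Properties.Semiring.Mult +-*-semiring as Mult
import Algebra.Properties.Semiring.Exp +-*-semiring as Exp
import Algebra.Properties.CommutativeSemiring.Binomial +-*-commutativeSemiring as Binomial

-- Fermat's little theorem

n∣n! : ∀ n .{{_ : ℕ.NonZero n}} → n ℕ.∣ n !
n∣n! (suc n) = ℕ.m∣m*n (n !)

module _ {p : ℕ} (p-prime : Prime p) where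

  prime∤k! : ∀ {k} → k ℕ.< p → ¬ p ℕ.∣ k !
  prime∤k! {zero}  _   p∣1    = ¬prime[1] (subst Prime (ℕ.∣1⇒≡1 p∣1) p-prime)
  prime∤k! {suc k} k<p p∣k+1! with euclidsLemma (suc k) (k !) p-prime p∣k+1!
  ... | inj₁ p∣k+1 = ℕ.<⇒≱ k<p (ℕ.∣⇒≤ p∣k+1)
  ... | inj₂ p∣k!  = prime∤k! (ℕ.<-trans (ℕ.n<1+n k) k<p) p∣k!

  prime∣pCk : ∀ {k} → 0 ℕ.< k → k ℕ.< p → p ℕ.∣ p C k
  prime∣pCk {k} 0<k k<p =
    [ id , ⊥-elim ∘ prime∤k!*[p-k]! ]′ (euclidsLemma (p C k) (k ! ℕ.* (p ∸ k) !) p-prime p∣pCk*k!*[p-k]!)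
    where
      k≤p : k ℕ.≤ p
      k≤p = ℕ.<⇒≤ k<p

      prime∤k!*[p-k]! : ¬ p ℕ.∣ k ! ℕ.* (p ∸ k) !
      prime∤k!*[p-k]! =
        [ prime∤k! k<p , prime∤k! (ℕ.∸-monoʳ-< 0<k k≤p) ]′ ∘ euclidsLemma (k !) ((p ∸ k) !) p-prime

      pCk*k!*[p-k]!≡p! : (p C k) ℕ.* (k ! ℕ.* (p ∸ k) !) ≡ p !
      pCk*k!*[p-k]!≡p! = trans (cong (ℕ._* (k ! ℕ.* (p ∸ k) !)) (nCk≡n!/k![n-k]! k≤p))
                               (m/n*n≡m {{ℕ._!*_!≢0 k (p ∸ k)}} (k![n∸k]!∣n! k≤p))

      p∣pCk*k!*[p-k]! : p ℕ.∣ (p C k) ℕ.* (k ! ℕ.* (p ∸ k) !)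
      p∣pCk*k!*[p-k]! = subst (p ℕ.∣_) (sym pCk*k!*[p-k]!≡p!) (n∣n! p {{prime⇒nonZero p-prime}})

1∣_ : ∀ i → 1ℤ ∣ i
1∣ i = divides i (sym (*-identityʳ i))

∣-sum : ∀ {k n} (f : Fin n → ℤ) → (∀ i → k ∣ f i) → k ∣ sum f
∣-sum {n = zero}  f k∣f = divides 0ℤ refl
∣-sum {n = suc n} f k∣f = ∣m∣n⇒∣m+n (k∣f Fin.zero) (∣-sum (f ∘ Fin.suc) (k∣f ∘ Fin.suc))

×≡* : ∀ n i → n Mult.× i ≡ + n * i
×≡* zero    i = sym (ℤ.*-zeroˡ i)
×≡* (suc n) i = trans (cong (_+_ i) (×≡* n i)) (i+m*i≡[1+m]*i (+ n) i)
  where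
    i+m*i≡[1+m]*i : ∀ m i → i + m * i ≡ (1ℤ + m) * i
    i+m*i≡[1+m]*i = solve-∀

^≡^ : ∀ i n → i Exp.^ n ≡ i ^ n
^≡^ i zero    = refl
^≡^ i (suc n) = cong (i *_) (^≡^ i n)

freshmansDream : ∀ {p} → Prime p → ∀ i j → + p ∣ (i + j) ^ p - (i ^ p + j ^ p)
freshmansDream {p@(suc m)} p-prime i j =
  subst (+ p ∣_) (sym (trans (cong (_- (i ^ p + j ^ p)) expansion) (cancel (i ^ p) (j ^ p) (sum middle))))
        (∣-sum middle p∣middle)
  where
    term : Fin (suc p) → ℤ
    term = Binomial.binomialTerm i j p

    middle : Fin m → ℤ
    middle k = term (Fin.suc (inject₁ k))

    p∣middle : ∀ k → + p ∣ middle k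
    p∣middle k = subst (+ p ∣_) (sym (×≡* c b)) (∣m⇒∣m*n b (∣ᵤ⇒∣ {+ p} {+ c} (prime∣pCk p-prime z<s 1+k<p)))
      where
        c : ℕ
        c = p C suc (toℕ (inject₁ k))
        b : ℤ
        b = Binomial.binomial i j p (Fin.suc (inject₁ k))
        1+k<p : suc (toℕ (inject₁ k)) ℕ.< p
        1+k<p = s<s (subst (ℕ._< m) (sym (toℕ-inject₁ k)) (toℕ<n k))

    first : term Fin.zero ≡ j ^ p
    first = begin
      term Fin.zero              ≡⟨ ×≡* 1 (1ℤ * j Exp.^ p) ⟩
      + 1 * (1ℤ * j Exp.^ p)     ≡⟨ *-identityˡ _ ⟩
      1ℤ * j Exp.^ p             ≡⟨ *-identityˡ _ ⟩
      j Exp.^ p                  ≡⟨ ^≡^ j p ⟩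
      j ^ p                      ∎
      where open ≡-Reasoning

    last : term (fromℕ p) ≡ i ^ p
    last = begin
      term (fromℕ p)
        ≡⟨ ×≡* (p C toℕ (fromℕ p)) (Binomial.binomial i j p (fromℕ p)) ⟩
      + (p C toℕ (fromℕ p)) * Binomial.binomial i j p (fromℕ p)
        ≡⟨ cong (λ k → + (p C k) * (i Exp.^ k * j Exp.^ (p ∸ k))) (toℕ-fromℕ p) ⟩
      + (p C p) * (i Exp.^ p * j Exp.^ (p ∸ p))
        ≡⟨ cong₂ (λ c e → + c * (i Exp.^ p * j Exp.^ e)) (nCn≡1 p) (ℕ.n∸n≡0 p) ⟩
      + 1 * (i Exp.^ p * 1ℤ)     ≡⟨ *-identityˡ _ ⟩
      i Exp.^ p * 1ℤ             ≡⟨ *-identityʳ _ ⟩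
      i Exp.^ p                  ≡⟨ ^≡^ i p ⟩
      i ^ p                      ∎
      where open ≡-Reasoning

    expansion : (i + j) ^ p ≡ j ^ p + (sum middle + i ^ p)
    expansion = begin
      (i + j) ^ p                                    ≡⟨ ^≡^ (i + j) p ⟨
      (i + j) Exp.^ p                                ≡⟨ Binomial.theorem p i j ⟩
      term Fin.zero + sum (term ∘ Fin.suc)           ≡⟨ cong (_+_ (term Fin.zero)) (sum-init-last (term ∘ Fin.suc)) ⟩
      term Fin.zero + (sum middle + term (fromℕ p))  ≡⟨ cong₂ (λ a b → a + (sum middle + b)) first last ⟩
      j ^ p + (sum middle + i ^ p)                   ∎
      where open ≡-Reasoning

    cancel : ∀ a b c → b + (c + a) - (a + b) ≡ c
    cancel = solve-∀

fermatsLittleTheorem : ∀ {p} → Prime p → ∀ n → + p ∣ (+ n) ^ p - + n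
fermatsLittleTheorem {suc _} p-prime zero    = divides 0ℤ refl
fermatsLittleTheorem {p}     p-prime (suc n) =
  subst (+ p ∣_) (sym (split ((1ℤ + + n) ^ p) ((+ n) ^ p) (+ n))) (∣m∣n⇒∣m+n dream (fermatsLittleTheorem p-prime n))
  where
    dream : + p ∣ (1ℤ + + n) ^ p - (1ℤ + (+ n) ^ p)
    dream = subst (λ o → + p ∣ (1ℤ + + n) ^ p - (o + (+ n) ^ p)) (^-zeroˡ p) (freshmansDream p-prime 1ℤ (+ n))

    split : ∀ a b x → a - (1ℤ + x) ≡ (a - (1ℤ + b)) + (b - x)
    split = solve-∀

-- Sums of two squares modulo a prime p ≡ 3 (mod 4)

module _ {p : ℕ} (p-prime : Prime p) where

  prime∣*⇒∣⊎∣ : ∀ i j → + p ∣ i * j → (+ p ∣ i) ⊎ (+ p ∣ j)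
  prime∣*⇒∣⊎∣ i j p∣ij = Sum.map ∣ᵤ⇒∣ ∣ᵤ⇒∣
    (euclidsLemma ℤ.∣ i ∣ ℤ.∣ j ∣ p-prime (subst (p ℕ.∣_) (ℤ.abs-* i j) (∣⇒∣ᵤ p∣ij)))

  prime∣i*i⇒∣i : ∀ i → + p ∣ i * i → + p ∣ i
  prime∣i*i⇒∣i i = Sum.reduce ∘ prime∣*⇒∣⊎∣ i i

i*i≡∣i∣*∣i∣ : ∀ i → i * i ≡ + ℤ.∣ i ∣ * + ℤ.∣ i ∣
i*i≡∣i∣*∣i∣ (+ n)    = refl
i*i≡∣i∣*∣i∣ -[1+ n ] = refl

∣a-b⇒∣aⁿ-bⁿ : ∀ {k a b} n → k ∣ a - b → k ∣ a ^ n - b ^ n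
∣a-b⇒∣aⁿ-bⁿ             zero    _     = divides 0ℤ refl
∣a-b⇒∣aⁿ-bⁿ {a = a} {b} (suc n) k∣a-b =
  subst (_ ∣_) (sym (telescope a b (a ^ n) (b ^ n)))
    (∣m∣n⇒∣m+n (∣n⇒∣m*n a (∣a-b⇒∣aⁿ-bⁿ n k∣a-b)) (∣m⇒∣m*n (b ^ n) k∣a-b))
  where
    telescope : ∀ a b x y → a * x - b * y ≡ a * (x - y) + (a - b) * y
    telescope = solve-∀

[-i]^odd≡-i^odd : ∀ i q → (- i) ^ suc (q ℕ.* 2) ≡ - i ^ suc (q ℕ.* 2)
[-i]^odd≡-i^odd i zero    = base i
  where
    base : ∀ i → (- i) * 1ℤ ≡ - (i * 1ℤ)
    base = solve-∀
[-i]^odd≡-i^odd i (suc q) =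
  trans (cong (λ x → (- i) * ((- i) * x)) ([-i]^odd≡-i^odd i q)) (step i (i ^ suc (q ℕ.* 2)))
  where
    step : ∀ i x → (- i) * ((- i) * (- x)) ≡ - (i * (i * x))
    step = solve-∀

∤⇒∣[x*x]^k-1 : ∀ {p k} → Prime p → p ≡ suc (k ℕ.* 2) → ∀ {x} → ¬ + p ∣ x → + p ∣ (x * x) ^ k - 1ℤ
∤⇒∣[x*x]^k-1 {p} {k} p-prime p≡1+2k {x} p∤x = subst (λ y → + p ∣ y - 1ℤ) (sym [x*x]^k≡a^2k)
  ([ ⊥-elim ∘ p∤a , id ]′ (prime∣*⇒∣⊎∣ p-prime a (a ^ (k ℕ.* 2) - 1ℤ) p∣a[a^2k-1]))
  where
    a : ℤ
    a = + ℤ.∣ x ∣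

    p∤a : ¬ + p ∣ a
    p∤a p∣a = p∤x (∣-trans p∣a ∣m∣∣m)

    p∣a[a^2k-1] : + p ∣ a * (a ^ (k ℕ.* 2) - 1ℤ)
    p∣a[a^2k-1] = subst (+ p ∣_) (factor a (a ^ (k ℕ.* 2)))
      (subst (λ n → + p ∣ a ^ n - a) p≡1+2k (fermatsLittleTheorem p-prime ℤ.∣ x ∣))
      where
        factor : ∀ a y → a * y - a ≡ a * (y - 1ℤ)
        factor = solve-∀

    [x*x]^k≡a^2k : (x * x) ^ k ≡ a ^ (k ℕ.* 2)
    [x*x]^k≡a^2k = begin
      (x * x) ^ k     ≡⟨ cong (_^ k) (i*i≡∣i∣*∣i∣ x) ⟩
      (a * a) ^ k     ≡⟨ cong (λ y → (a * y) ^ k) (*-identityʳ a) ⟨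
      (a ^ 2) ^ k     ≡⟨ ^-*-assoc a 2 k ⟩
      a ^ (2 ℕ.* k)   ≡⟨ cong (a ^_) (ℕ.*-comm 2 k) ⟩
      a ^ (k ℕ.* 2)   ∎
      where open ≡-Reasoning

module _ {p : ℕ} (p-prime : Prime p) (p%4≡3 : p % 4 ≡ 3) where

  private
    q k : ℕ
    q = p / 4
    k = suc (q ℕ.* 2)

    p≡1+2k : p ≡ suc (k ℕ.* 2)
    p≡1+2k = begin
      p                    ≡⟨ m≡m%n+[m/n]*n p 4 ⟩
      p % 4 ℕ.+ q ℕ.* 4    ≡⟨ cong (ℕ._+ q ℕ.* 4) p%4≡3 ⟩
      3 ℕ.+ q ℕ.* 4        ≡⟨ cong (3 ℕ.+_) (ℕ.*-assoc q 2 2) ⟨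
      suc (k ℕ.* 2)        ∎
      where open ≡-Reasoning

    p∤2 : ¬ + p ∣ + 2
    p∤2 p∣2 = ℕ.<⇒≱ (s<s (s<s z<s)) (subst (ℕ._≤ 2) p≡1+2k (ℕ.∣⇒≤ (∣⇒∣ᵤ p∣2)))

  -- If p ∤ x, y, then for the odd k = (p − 1)/2 both (x²)ᵏ and (y²)ᵏ are ≡ 1, while x² ≡ −y² gives
  -- (x²)ᵏ ≡ −(y²)ᵏ; hence p ∣ 2.
  prime≡3mod4∣x²+y²⇒∣x : ∀ x y → + p ∣ x * x + y * y → + p ∣ x
  prime≡3mod4∣x²+y²⇒∣x x y p∣x²+y² with + p ∣? y | + p ∣? x
  ... | yes p∣y | _       = prime∣i*i⇒∣i p-prime x (∣m+n∣n⇒∣m p∣x²+y² (∣m⇒∣m*n y p∣y))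
  ... | no  _   | yes p∣x = p∣x
  ... | no  p∤y | no  p∤x = ⊥-elim (p∤2 (subst (+ p ∣_) (two A B) p∣[A+B]-[A-1]-[B-1]))
    where
      A B : ℤ
      A = (x * x) ^ k
      B = (y * y) ^ k

      p∣A+B : + p ∣ A - - B
      p∣A+B = subst (λ z → + p ∣ A - z) ([-i]^odd≡-i^odd (y * y) q)
        (∣a-b⇒∣aⁿ-bⁿ {a = x * x} {b = - (y * y)} k (subst (+ p ∣_) (sym (sub-neg (x * x) (y * y))) p∣x²+y²))
        where
          sub-neg : ∀ a b → a - - b ≡ a + b
          sub-neg = solve-∀

      p∣[A+B]-[A-1]-[B-1] : + p ∣ (A - - B) - (A - 1ℤ) - (B - 1ℤ)
      p∣[A+B]-[A-1]-[B-1] = ∣m∣n⇒∣m-n (∣m∣n⇒∣m-n p∣A+B (∤⇒∣[x*x]^k-1 {k = k} p-prime p≡1+2k p∤x))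
                                      (∤⇒∣[x*x]^k-1 {k = k} p-prime p≡1+2k p∤y)

      two : ∀ a b → (a - - b) - (a - 1ℤ) - (b - 1ℤ) ≡ + 2
      two = solve-∀

-- Descent for u² + v² = d (s² + t²)

n<m^n : ∀ {m} → 1 ℕ.< m → ∀ n → n ℕ.< m ℕ.^ n
n<m^n             1<m zero    = z<s
n<m^n {m@(suc _)} 1<m (suc n) = ℕ.≤-<-trans (n<m^n 1<m n)
  (subst (m ℕ.^ n ℕ.<_) (ℕ.*-comm (m ℕ.^ n) m) (ℕ.m<m*n (m ℕ.^ n) m {{ℕ.m^n≢0 m n}} 1<m))

∀mⁿ∣i⇒i≡0 : ∀ {m i} → 1 ℕ.< m → (∀ n → + (m ℕ.^ n) ∣ i) → i ≡ 0ℤ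
∀mⁿ∣i⇒i≡0 {m} {i} 1<m mⁿ∣i with ℤ.∣ i ∣ ℕ.≟ 0
... | yes ∣i∣≡0 = ℤ.∣i∣≡0⇒i≡0 ∣i∣≡0
... | no  ∣i∣≢0 =
  ⊥-elim (ℕ.<⇒≱ (n<m^n 1<m ℤ.∣ i ∣) (ℕ.∣⇒≤ {{ℕ.≢-nonZero ∣i∣≢0}} (∣⇒∣ᵤ (mⁿ∣i ℤ.∣ i ∣))))

sumSq : ℤ × ℤ → ℤ
sumSq (u , v) = u * u + v * v

Solution : ℤ → ℤ × ℤ → ℤ × ℤ → Set
Solution d x y = sumSq x ≡ d * sumSq y

infix 4 _∣²_
_∣²_ : ℤ → ℤ × ℤ → Set
k ∣² (u , v) = (k ∣ u) × (k ∣ v)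

∣²⇒*∣sumSq : ∀ {k x} → k ∣² x → k * k ∣ sumSq x
∣²⇒*∣sumSq {k} (divides a refl , divides b refl) = divides (a * a + b * b) (factor a b k)
  where
    factor : ∀ a b k → (a * k) * (a * k) + (b * k) * (b * k) ≡ (a * a + b * b) * (k * k)
    factor = solve-∀

module _ {p : ℕ} (p-prime : Prime p) (p%4≡3 : p % 4 ≡ 3) {e : ℤ} (p∤e : ¬ + p ∣ e) where

  private
    instance
      p≢0 : ℕ.NonZero p
      p≢0 = prime⇒nonZero p-prime

  prime∣sumSq⇒∣² : ∀ x → + p ∣ sumSq x → + p ∣² x
  prime∣sumSq⇒∣² (u , v) p∣u²+v² =
    prime≡3mod4∣x²+y²⇒∣x p-prime p%4≡3 u v p∣u²+v² ,
    prime≡3mod4∣x²+y²⇒∣x p-prime p%4≡3 v u (subst (+ p ∣_) (ℤ.+-comm (u * u) (v * v)) p∣u²+v²)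

  solution⇒∣² : ∀ {x y} → Solution (e * + p) x y → (+ p ∣² x) × (+ p ∣² y)
  solution⇒∣² {x} {y} sol = p∣²x , prime∣sumSq⇒∣² y p∣sumSq-y
    where
      sol′ : sumSq x ≡ (e * sumSq y) * + p
      sol′ = trans sol (reassoc e (+ p) (sumSq y))
        where
          reassoc : ∀ e p n → e * p * n ≡ (e * n) * p
          reassoc = solve-∀

      p∣²x : + p ∣² x
      p∣²x = prime∣sumSq⇒∣² x (divides (e * sumSq y) sol′)

      p∣sumSq-y : + p ∣ sumSq y
      p∣sumSq-y = [ ⊥-elim ∘ p∤e , id ]′ (prime∣*⇒∣⊎∣ p-prime e (sumSq y)
        (*-cancelʳ-∣ (+ p) (subst (+ p * + p ∣_) sol′ (∣²⇒*∣sumSq p∣²x))))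

  solution-÷p : ∀ {a b c d} → Solution (e * + p) (a * + p , b * + p) (c * + p , d * + p) →
                Solution (e * + p) (a , b) (c , d)
  solution-÷p {a} {b} {c} {d} sol = ℤ.*-cancelˡ-≡ (+ p) _ _ (ℤ.*-cancelˡ-≡ (+ p) _ _
    (trans (sym (lhs a b (+ p))) (trans sol (rhs e c d (+ p)))))
    where
      lhs : ∀ a b p → (a * p) * (a * p) + (b * p) * (b * p) ≡ p * (p * (a * a + b * b))
      lhs = solve-∀
      rhs : ∀ e c d p → e * p * ((c * p) * (c * p) + (d * p) * (d * p)) ≡ p * (p * (e * p * (c * c + d * d)))
      rhs = solve-∀

  pⁿ∣solution : ∀ n {u v s t} → Solution (e * + p) (u , v) (s , t) →
                (+ (p ℕ.^ n) ∣² (u , v)) × (+ (p ℕ.^ n) ∣² (s , t))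
  pⁿ∣solution zero    {u} {v} {s} {t} _ = (1∣ u , 1∣ v) , (1∣ s , 1∣ t)
  pⁿ∣solution (suc n) sol = descend (solution⇒∣² sol) sol
    where
      times-p : ∀ {i} → + (p ℕ.^ n) ∣ i → + (p ℕ.^ suc n) ∣ i * + p
      times-p {i} pⁿ∣i = subst₂ _∣_ (sym (ℤ.pos-* p (p ℕ.^ n))) (ℤ.*-comm (+ p) i) (*-monoʳ-∣ (+ p) pⁿ∣i)

      descend : ∀ {u v s t} → (+ p ∣² (u , v)) × (+ p ∣² (s , t)) → Solution (e * + p) (u , v) (s , t) →
                (+ (p ℕ.^ suc n) ∣² (u , v)) × (+ (p ℕ.^ suc n) ∣² (s , t))
      descend ((divides a refl , divides b refl) , (divides c refl , divides d refl)) sol =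
        Product.map (Product.map times-p times-p) (Product.map times-p times-p)
          (pⁿ∣solution n {a} {b} {c} {d} (solution-÷p {a} {b} {c} {d} sol))

  solution⇒trivial : ∀ {u v s t} → Solution (e * + p) (u , v) (s , t) → (u ≡ 0ℤ × v ≡ 0ℤ) × (s ≡ 0ℤ × t ≡ 0ℤ)
  solution⇒trivial {u} {v} {s} {t} sol =
    (vanishes (proj₁ ∘ proj₁) , vanishes (proj₂ ∘ proj₁)) , (vanishes (proj₁ ∘ proj₂) , vanishes (proj₂ ∘ proj₂))
    where
      vanishes : ∀ {i} → (∀ {k} → (k ∣² (u , v)) × (k ∣² (s , t)) → k ∣ i) → i ≡ 0ℤ
      vanishes component = ∀mⁿ∣i⇒i≡0 (ℕ.nonTrivial⇒n>1 p {{prime⇒nonTrivial p-prime}})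
                                     (λ n → component (pⁿ∣solution n sol))

-- Clearing denominators

fromℚᵘ-homo-+ : ∀ a b → fromℚᵘ (a ℚᵘ.+ b) ≡ fromℚᵘ a ℚ.+ fromℚᵘ b
fromℚᵘ-homo-+ a b = ℚ.toℚᵘ-injective (begin
  toℚᵘ (fromℚᵘ (a ℚᵘ.+ b))                ≈⟨ ℚ.toℚᵘ-fromℚᵘ (a ℚᵘ.+ b) ⟩
  a ℚᵘ.+ b                                ≈⟨ ℚᵘ.+-cong (ℚ.toℚᵘ-fromℚᵘ a) (ℚ.toℚᵘ-fromℚᵘ b) ⟨
  toℚᵘ (fromℚᵘ a) ℚᵘ.+ toℚᵘ (fromℚᵘ b)    ≈⟨ ℚ.toℚᵘ-homo-+ (fromℚᵘ a) (fromℚᵘ b) ⟨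
  toℚᵘ (fromℚᵘ a ℚ.+ fromℚᵘ b)            ∎)
  where open ℚᵘ.≃-Reasoning

fromℚᵘ-homo-* : ∀ a b → fromℚᵘ (a ℚᵘ.* b) ≡ fromℚᵘ a ℚ.* fromℚᵘ b
fromℚᵘ-homo-* a b = ℚ.toℚᵘ-injective (begin
  toℚᵘ (fromℚᵘ (a ℚᵘ.* b))                ≈⟨ ℚ.toℚᵘ-fromℚᵘ (a ℚᵘ.* b) ⟩
  a ℚᵘ.* b                                ≈⟨ ℚᵘ.*-cong (ℚ.toℚᵘ-fromℚᵘ a) (ℚ.toℚᵘ-fromℚᵘ b) ⟨
  toℚᵘ (fromℚᵘ a) ℚᵘ.* toℚᵘ (fromℚᵘ b)    ≈⟨ ℚ.toℚᵘ-homo-* (fromℚᵘ a) (fromℚᵘ b) ⟨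
  toℚᵘ (fromℚᵘ a ℚ.* fromℚᵘ b)            ∎)
  where open ℚᵘ.≃-Reasoning

fromℤ : ℤ → ℚ
fromℤ i = i ℚ./ 1

fromℤ-homo-+ : ∀ i j → fromℤ (i + j) ≡ fromℤ i ℚ.+ fromℤ j
fromℤ-homo-+ i j = trans
  (ℚ.fromℚᵘ-cong {mkℚᵘ (i + j) 0} {mkℚᵘ i 0 ℚᵘ.+ mkℚᵘ j 0} (*≡* (cross i j)))
  (fromℚᵘ-homo-+ (mkℚᵘ i 0) (mkℚᵘ j 0))
  where
    cross : ∀ i j → (i + j) * + 1 ≡ (i * + 1 + j * + 1) * + 1
    cross = solve-∀

fromℤ-homo-* : ∀ i j → fromℤ (i * j) ≡ fromℤ i ℚ.* fromℤ j
fromℤ-homo-* i j = fromℚᵘ-homo-* (mkℚᵘ i 0) (mkℚᵘ j 0)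

fromℤ-injective : ∀ {i j} → fromℤ i ≡ fromℤ j → i ≡ j
fromℤ-injective {i} {j} eq with ℚ.fromℚᵘ-injective {mkℚᵘ i 0} {mkℚᵘ j 0} eq
... | *≡* i*1≡j*1 = trans (sym (*-identityʳ i)) (trans i*1≡j*1 (*-identityʳ j))

fromℤ-sumSq : ∀ i j → fromℤ (sumSq (i , j)) ≡ fromℤ i ℚ.* fromℤ i ℚ.+ fromℤ j ℚ.* fromℤ j
fromℤ-sumSq i j = trans (fromℤ-homo-+ (i * i) (j * j)) (cong₂ ℚ._+_ (fromℤ-homo-* i i) (fromℤ-homo-* j j))

fromℤ↥≡*fromℤ↧ : ∀ r → fromℤ (↥ r) ≡ r ℚ.* fromℤ (↧ r)
fromℤ↥≡*fromℤ↧ r@record{} = begin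
  fromℤ (↥ r)                          ≡⟨ ℚ.fromℚᵘ-cong {mkℚᵘ (↥ r) 0} {toℚᵘ r ℚᵘ.* mkℚᵘ (↧ r) 0} (*≡* cross) ⟩
  fromℚᵘ (toℚᵘ r ℚᵘ.* mkℚᵘ (↧ r) 0)    ≡⟨ fromℚᵘ-homo-* (toℚᵘ r) (mkℚᵘ (↧ r) 0) ⟩
  fromℚᵘ (toℚᵘ r) ℚ.* fromℤ (↧ r)      ≡⟨ cong (ℚ._* fromℤ (↧ r)) (ℚ.fromℚᵘ-toℚᵘ r) ⟩
  r ℚ.* fromℤ (↧ r)                    ∎
  where
    open ≡-Reasoning
    cross : ↥ r * ℤ.+[1+ ℚ.denominator-1 r ℕ.* 1 ] ≡ ↥ r * ↧ r * + 1
    cross = trans (cong (λ n → ↥ r * ℤ.+[1+ n ]) (ℕ.*-identityʳ _)) (sym (*-identityʳ _))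

*fromℤ↧*≡fromℤ↥* : ∀ r k → r ℚ.* fromℤ (↧ r * k) ≡ fromℤ (↥ r * k)
*fromℤ↧*≡fromℤ↥* r k = begin
  r ℚ.* fromℤ (↧ r * k)              ≡⟨ cong (r ℚ.*_) (fromℤ-homo-* (↧ r) k) ⟩
  r ℚ.* (fromℤ (↧ r) ℚ.* fromℤ k)    ≡⟨ ℚ.*-assoc r (fromℤ (↧ r)) (fromℤ k) ⟨
  r ℚ.* fromℤ (↧ r) ℚ.* fromℤ k      ≡⟨ cong (ℚ._* fromℤ k) (fromℤ↥≡*fromℤ↧ r) ⟨
  fromℤ (↥ r) ℚ.* fromℤ k            ≡⟨ fromℤ-homo-* (↥ r) k ⟨
  fromℤ (↥ r * k)                    ∎
  where open ≡-Reasoning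

↥*≡0⇒≡0 : ∀ r k .{{_ : ℤ.NonZero k}} → ↥ r * k ≡ 0ℤ → r ≡ 0ℚ
↥*≡0⇒≡0 r k ↥r*k≡0 = ℚ.↥p≡0⇒p≡0 r (ℤ.*-cancelʳ-≡ (↥ r) 0ℤ k ↥r*k≡0)

-- U, V, S, T are u, v, s, t multiplied by the product D of their four denominators.
module ClearDenominators (u v s t : ℚ) where

  U V S T : ℤ
  U = ↥ u * (↧ v * ↧ s * ↧ t)
  V = ↥ v * (↧ u * ↧ s * ↧ t)
  S = ↥ s * (↧ u * ↧ v * ↧ t)
  T = ↥ t * (↧ u * ↧ v * ↧ s)

  clearDenominators : ∀ d → u ℚ.* u ℚ.+ v ℚ.* v ≡ fromℤ d ℚ.* (s ℚ.* s ℚ.+ t ℚ.* t) → Solution d (U , V) (S , T)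
  clearDenominators d eq = fromℤ-injective (begin
    fromℤ (sumSq (U , V))                                       ≡⟨ fromℤ-sumSq U V ⟩
    sq+sq (fromℤ U) (fromℤ V)                                   ≡⟨ cong₂ sq+sq (scale u refl) (scale v D≡↧v*) ⟨
    sq+sq (u ℚ.* D′) (v ℚ.* D′)                                 ≡⟨ pull u v D′ ⟩
    D′ ℚ.* D′ ℚ.* (u ℚ.* u ℚ.+ v ℚ.* v)                         ≡⟨ cong (D′ ℚ.* D′ ℚ.*_) eq ⟩
    D′ ℚ.* D′ ℚ.* (fromℤ d ℚ.* (s ℚ.* s ℚ.+ t ℚ.* t))           ≡⟨ push (fromℤ d) s t D′ ⟩
    fromℤ d ℚ.* sq+sq (s ℚ.* D′) (t ℚ.* D′)                     ≡⟨ cong₂ (λ x y → fromℤ d ℚ.* sq+sq x y)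
                                                                         (scale s D≡↧s*) (scale t D≡↧t*) ⟩
    fromℤ d ℚ.* sq+sq (fromℤ S) (fromℤ T)                       ≡⟨ cong (fromℤ d ℚ.*_) (fromℤ-sumSq S T) ⟨
    fromℤ d ℚ.* fromℤ (sumSq (S , T))                           ≡⟨ fromℤ-homo-* d (sumSq (S , T)) ⟨
    fromℤ (d * sumSq (S , T))                                   ∎)
    where
      open ≡-Reasoning
      open +-*-Solver using (solve; _:+_; _:*_; _:=_)

      sq+sq : ℚ → ℚ → ℚ
      sq+sq x y = x ℚ.* x ℚ.+ y ℚ.* y

      D : ℤ
      D = ↧ u * (↧ v * ↧ s * ↧ t)
      D′ : ℚ
      D′ = fromℤ D

      scale : ∀ r {k} → D ≡ ↧ r * k → r ℚ.* D′ ≡ fromℤ (↥ r * k)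
      scale r {k} D≡ = trans (cong (λ x → r ℚ.* fromℤ x) D≡) (*fromℤ↧*≡fromℤ↥* r k)

      D≡↧v* : D ≡ ↧ v * (↧ u * ↧ s * ↧ t)
      D≡↧v* = reorder (↧ u) (↧ v) (↧ s) (↧ t)
        where reorder : ∀ a b c e → a * (b * c * e) ≡ b * (a * c * e)
              reorder = solve-∀
      D≡↧s* : D ≡ ↧ s * (↧ u * ↧ v * ↧ t)
      D≡↧s* = reorder (↧ u) (↧ v) (↧ s) (↧ t)
        where reorder : ∀ a b c e → a * (b * c * e) ≡ c * (a * b * e)
              reorder = solve-∀
      D≡↧t* : D ≡ ↧ t * (↧ u * ↧ v * ↧ s)
      D≡↧t* = reorder (↧ u) (↧ v) (↧ s) (↧ t)
        where reorder : ∀ a b c e → a * (b * c * e) ≡ e * (a * b * c)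
              reorder = solve-∀

      pull : ∀ u v D → sq+sq (u ℚ.* D) (v ℚ.* D) ≡ D ℚ.* D ℚ.* (u ℚ.* u ℚ.+ v ℚ.* v)
      pull = solve 3 (λ u v D → (u :* D) :* (u :* D) :+ (v :* D) :* (v :* D) := D :* D :* (u :* u :+ v :* v)) refl

      push : ∀ d s t D → D ℚ.* D ℚ.* (d ℚ.* (s ℚ.* s ℚ.+ t ℚ.* t)) ≡ d ℚ.* sq+sq (s ℚ.* D) (t ℚ.* D)
      push = solve 4 (λ d s t D → D :* D :* (d :* (s :* s :+ t :* t))
                                  := d :* ((s :* D) :* (s :* D) :+ (t :* D) :* (t :* D))) refl

module _ {p : ℕ} (p-prime : Prime p) (p%4≡3 : p % 4 ≡ 3) {e : ℤ} (p∤e : ¬ + p ∣ e) where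

  rational-solution⇒trivial : ∀ u v s t → u ℚ.* u ℚ.+ v ℚ.* v ≡ fromℤ (e * + p) ℚ.* (s ℚ.* s ℚ.+ t ℚ.* t) →
                              (u ≡ 0ℚ × v ≡ 0ℚ) × (s ≡ 0ℚ × t ≡ 0ℚ)
  rational-solution⇒trivial u v s t eq =
    let ((U≡0 , V≡0) , (S≡0 , T≡0)) = integral-trivial in
    (↥*≡0⇒≡0 u (↧ v * ↧ s * ↧ t) U≡0 , ↥*≡0⇒≡0 v (↧ u * ↧ s * ↧ t) V≡0) ,
    (↥*≡0⇒≡0 s (↧ u * ↧ v * ↧ t) S≡0 , ↥*≡0⇒≡0 t (↧ u * ↧ v * ↧ s) T≡0)
    where
      open ClearDenominators u v s t
      integral-trivial : (U ≡ 0ℤ × V ≡ 0ℤ) × (S ≡ 0ℤ × T ≡ 0ℤ)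
      integral-trivial = solution⇒trivial p-prime p%4≡3 p∤e {U} {V} {S} {T} (clearDenominators (e * + p) eq)

-- The norm equation

norm≡1+√2⇒sumSq : ∀ d q₁ q₂ q₃ q₄ → NormK₁ d ((q₁ , q₂) , (q₃ , q₄)) ≡ ι 1+√2 →
  (q₁ ℚ.- q₂) ℚ.* (q₁ ℚ.- q₂) ℚ.+ q₂ ℚ.* q₂ ≡ fromℤ d ℚ.* ((q₃ ℚ.- q₄) ℚ.* (q₃ ℚ.- q₄) ℚ.+ q₄ ℚ.* q₄)
norm≡1+√2⇒sumSq d q₁ q₂ q₃ q₄ eq = begin
  (q₁ ℚ.- q₂) ℚ.* (q₁ ℚ.- q₂) ℚ.+ q₂ ℚ.* q₂   ≡⟨ difference ⟩
  rhs ℚ.+ (rational ℚ.- irrational)           ≡⟨ cong₂ (λ x y → rhs ℚ.+ (x ℚ.- y)) (cong (proj₁ ∘ proj₁) eq)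
                                                                                 (cong (proj₂ ∘ proj₁) eq) ⟩
  rhs ℚ.+ 0ℚ                                  ≡⟨ ℚ.+-identityʳ rhs ⟩
  rhs                                         ∎
  where
    open ≡-Reasoning
    open +-*-Solver using (solve; _:+_; _:*_; _:-_; :-_; _:=_; con)

    rhs rational irrational two : ℚ
    rhs        = fromℤ d ℚ.* ((q₃ ℚ.- q₄) ℚ.* (q₃ ℚ.- q₄) ℚ.+ q₄ ℚ.* q₄)
    rational   = proj₁ (proj₁ (NormK₁ d ((q₁ , q₂) , (q₃ , q₄))))
    irrational = proj₂ (proj₁ (NormK₁ d ((q₁ , q₂) , (q₃ , q₄))))
    two        = + 2 ℚ./ 1

    difference : (q₁ ℚ.- q₂) ℚ.* (q₁ ℚ.- q₂) ℚ.+ q₂ ℚ.* q₂ ≡ rhs ℚ.+ (rational ℚ.- irrational)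
    difference = solve 5 (λ q₁ q₂ q₃ q₄ D →
      (q₁ :- q₂) :* (q₁ :- q₂) :+ q₂ :* q₂
        := D :* ((q₃ :- q₄) :* (q₃ :- q₄) :+ q₄ :* q₄)
           :+ ((q₁ :* q₁ :+ con two :* (q₂ :* q₂)
                 :+ (D :* (q₃ :* (:- q₃) :+ con two :* (q₄ :* (:- q₄)))
                     :+ con two :* (con 0ℚ :* (q₃ :* (:- q₄) :+ q₄ :* (:- q₃)))))
               :- (q₁ :* q₂ :+ q₂ :* q₁
                 :+ (D :* (q₃ :* (:- q₄) :+ q₄ :* (:- q₃))
                     :+ con 0ℚ :* (q₃ :* (:- q₃) :+ con two :* (q₄ :* (:- q₄)))))))
      refl q₁ q₂ q₃ q₄ (fromℤ d)

x-y≡0∧y≡0⇒x≡0 : ∀ {x y} → x ℚ.- y ≡ 0ℚ → y ≡ 0ℚ → x ≡ 0ℚ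
x-y≡0∧y≡0⇒x≡0 {x} x-0≡0 refl = trans (sym (ℚ.+-identityʳ x)) x-0≡0

squarefree∧d≡ep⇒p∤e : ∀ {d e p} → SquareFree d → Prime p → d ≡ e * + p → ¬ + p ∣ e
squarefree∧d≡ep⇒p∤e {d} {e} {p} sf p-prime d≡ep p∣e = ¬prime[1] (subst Prime (sf p p²∣d) p-prime)
  where
    p²∣d : (p ℕ.* p) ℕ.∣ ℤ.∣ d ∣
    p²∣d = subst₂ ℕ._∣_ (ℤ.abs-* (+ p) (+ p)) (cong ℤ.∣_∣ (sym d≡ep)) (∣⇒∣ᵤ (*-monoˡ-∣ (+ p) p∣e))

proposition3p3 : (d : ℤ) → SquareFree d → HasPrimeFactor3mod4 d →
    ¬ (∃[ α ] (¬ (α ≡ 0K₁) × NormK₁ d α ≡ ι 1+√2))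
proposition3p3 d sf (p , p-prime , p∣d , p%4≡3) (((q₁ , q₂) , (q₃ , q₄)) , α≢0 , Nα≡1+√2) = α≢0 α≡0
  where
    open _∣_ (∣ᵤ⇒∣ {+ p} {d} p∣d) using () renaming (quotient to e; equality to d≡ep)

    trivial : ((q₁ ℚ.- q₂) ≡ 0ℚ × q₂ ≡ 0ℚ) × ((q₃ ℚ.- q₄) ≡ 0ℚ × q₄ ≡ 0ℚ)
    trivial = rational-solution⇒trivial p-prime p%4≡3 (squarefree∧d≡ep⇒p∤e {d} {e} {p} sf p-prime d≡ep)
      (q₁ ℚ.- q₂) q₂ (q₃ ℚ.- q₄) q₄
      (subst (λ i → _ ≡ fromℤ i ℚ.* _) d≡ep (norm≡1+√2⇒sumSq d q₁ q₂ q₃ q₄ Nα≡1+√2))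

    α≡0 : ((q₁ , q₂) , (q₃ , q₄)) ≡ 0K₁
    α≡0 = let ((q₁-q₂≡0 , q₂≡0) , (q₃-q₄≡0 , q₄≡0)) = trivial in
      cong₂ _,_ (cong₂ _,_ (x-y≡0∧y≡0⇒x≡0 q₁-q₂≡0 q₂≡0) q₂≡0)
                (cong₂ _,_ (x-y≡0∧y≡0⇒x≡0 q₃-q₄≡0 q₄≡0) q₄≡0)
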